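{- Let $G$ be a graph and let $p\geq 2$ be an integer. Then $\mathrm{id}^{\leq p}(G) \leq \left\lceil\frac{|E(G)|}{\lfloor p/2\rfloor}\right\rceil + \frac{1}{2}p^2$.
   Context: All graphs are finite and simple. An orientation of $G$ assigns a direction to each edge (vertices are labelled, so two orientations differ if some edge is oriented differently). In an oriented graph, the inversion of a vertex set $X$ reverses the orientation of every arc with both endvertices in $X$; a $(\leq p)$-inversion is the inversion of a set of at most $p$ vertices. The $(\leq p)$-inversion graph of $G$ has as vertices the orientations of $G$, two being adjacent if one $(\leq p)$-inversion transforms one into the other. The $(\leq p)$-inversion diameter $\mathrm{id}^{\leq p}(G)$ is the diameter of this graph, i.e. the maximum over all pairs of orientations $\vec G_1,\vec G_2$ of $G$ of the minimum number of $(\leq p)$-inversions whose successive application transforms $\vec G_1$ into $\vec G_2$. -}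

module Defs where

open import Data.Nat using (ℕ; zero; suc; _+_; _≤_; _<_)
open import Data.Nat.DivMod using (_/_)
open import Data.Fin using (Fin; toℕ)
open import Data.Fin.Subset using (Subset; ∣_∣)
open import Data.Bool using (Bool; not; _∧_; if_then_else_)
open import Data.Product using (_×_; proj₁; proj₂)
open import Data.List using (List; foldl)
open import Data.Vec using (lookup)
open import Relation.Binary.PropositionalEquality using (_≡_)

-- Edge e joins (proj₁ (ends e)) and (proj₂ (ends e)), stored with the
-- smaller endpoint first (so no loops), and distinct edge indices have
-- distinct endpoint pairs (so no parallel edges).  |E(G)| = m.
record Graph : Set where
  field
    n       : ℕ
    m       : ℕ
    ends    : Fin m → Fin n × Fin n
    ordered : ∀ e → toℕ (proj₁ (ends e)) < toℕ (proj₂ (ends e))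
    simple  : ∀ e f → ends e ≡ ends f → e ≡ f

open Graph public

-- An orientation assigns to each edge a direction:
-- true = from proj₁ (ends e) to proj₂ (ends e), false = the reverse.
Orientation : Graph → Set
Orientation G = Fin (m G) → Bool

invert : (G : Graph) → Orientation G → Subset (n G) → Orientation G
invert G o X e =
  if lookup X (proj₁ (ends G e)) ∧ lookup X (proj₂ (ends G e))
  then not (o e) else o e

invertAll : (G : Graph) → Orientation G → List (Subset (n G)) → Orientation G
invertAll G = foldl (invert G)

-- Ceiling division ⌈ a / d ⌉ for d ≥ 1 (value 0 for d = 0, never used).
ceilDiv : ℕ → ℕ → ℕ
ceilDiv a zero    = zero
ceilDiv a (suc k) = (a + k) / suc k

module Submission where

-- Let k = ⌊p/2⌋, so that 2k ≤ p. We settle the vertices group by group, keeping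
-- every edge at a settled vertex correctly oriented, and make each inversion pay
-- for k edges of the graph G − S left by the settled vertices S. If G − S has a
-- vertex v of degree d ≥ k, the wrongly oriented edges at v are corrected in
-- chunks of p − 1 by inverting v together with their other ends: at most d/k
-- inversions for d edges. Otherwise, starting from a vertex of maximum degree
-- D < k, greedily collect vertices of positive degree at pairwise distance at
-- least 3 in G − S. Once their degrees add up to at least k, one inversion of
-- these centres and their wrongly oriented neighbours (at most 2k ≤ p vertices)
-- corrects all their edges. If the collection ends first, every edge of G − S has
-- an end within distance 2 of centres of total degree less than k; these are at
-- most k(k+1) vertices, and one inversion each finishes. Altogether there are at
-- most ⌈m/k⌉ + k(k+1) ≤ ⌈m/k⌉ + p²/2 inversions.


open import Defs

open import Data.Bool using (Bool; true; false; not; _∧_; if_then_else_)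
import Data.Bool as Bool
open import Data.Bool.Properties using (¬-not)
open import Data.Empty using (⊥; ⊥-elim)
open import Data.Fin using (Fin; zero; suc; toℕ; _≟_)
open import Data.Fin.Properties using (any?)
open import Data.Fin.Subset using (Subset; ∣_∣) renaming (⊥ to ∅)
open import Data.Fin.Subset.Properties using (∣⊥∣≡0)
open import Data.List using (List; []; _∷_; _++_; length; map; concatMap; filter; allFin; foldr; take; drop)
open import Data.List.Extrema.Nat using (argmax; f[xs]≤f[argmax]; f[⊥]≤f[argmax])
open import Data.List.Membership.Propositional using (_∈_; _∉_; find; lose)
open import Data.List.Membership.Propositional.Properties
  using (∈-allFin; ∈-filter⁺; ∈-filter⁻; ∈-map⁺; ∈-map⁻; ∈-++⁺ˡ; ∈-++⁺ʳ; ∈-++⁻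
        ; ∈-concatMap⁺; ∈-concatMap⁻)
open import Data.List.Properties
  using (length-take; length-drop; length-++; length-map; length-filter; length-tabulate
        ; filter-some; filter-≐; foldl-++; take++drop≡id)
open import Data.List.Relation.Unary.All as All using (All; []; _∷_)
open import Data.List.Relation.Unary.All.Properties using (++⁺)
open import Data.List.Relation.Unary.AllPairs using (AllPairs; []; _∷_)
open import Data.List.Relation.Unary.Any using (here; there)
open import Data.List.Relation.Unary.Unique.Propositional using (Unique)
open import Data.List.Relation.Unary.Unique.Propositional.Properties using (drop⁺; filter⁺; allFin⁺)
open import Data.Nat
  using (ℕ; zero; suc; _+_; _*_; _∸_; _⊔_; _≤_; _<_; z≤n; s≤s; _≤?_; _<?_; ⌊_/2⌋; ⌈_/2⌉; NonZero; >-nonZero⁻¹)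
open import Data.Nat.DivMod using (_/_; m*n/n≡m; /-monoˡ-≤)
open import Data.Nat.Induction using (<-wellFounded)
open import Data.Nat.ListAction using (sum)
open import Data.Nat.Properties
  using ( *-assoc; *-cancelˡ-≤; *-comm; *-distribʳ-+; *-distribˡ-+; *-distribˡ-∸; *-identityʳ; *-mono-≤
        ; *-monoʳ-≤; *-suc; *-zeroʳ; +-assoc; +-comm; +-distribˡ-⊔; +-identityʳ; +-mono-≤; +-monoʳ-≤
        ; +-monoˡ-≤; +-suc; <-asym; <⇒≢; <⇒≤; m+[n∸m]≡n; m+n∸n≡m; m<m+n; m≤m+n; m≤m⊔n; m≤n+m; m≤n+m∸n
        ; m≤n⇒m∸n≡0; m≤n⇒m≤1+n; m≤n⇒m⊔n≡n; m≤n⊔m; m≥n⇒m⊔n≡m; m⊓n≤m; n≤1+n; ∸-monoʳ-<; ∸-monoˡ-≤; ≤-<-trans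
        ; ≤-pred; ≤-refl; ≤-reflexive; ≤-trans; ≰⇒>; ⊔-lub; ⊔-monoʳ-≤; ⌊n/2⌋+⌈n/2⌉≡n; ⌊n/2⌋≤⌈n/2⌉
        ; +-commutativeSemigroup; module ≤-Reasoning
        )
open import Algebra.Properties.CommutativeSemigroup +-commutativeSemigroup using (x∙yz≈y∙xz)
open import Data.Product using (∃; _×_; _,_; proj₁; proj₂; uncurry)
open import Data.Sum using (_⊎_; inj₁; inj₂; [_,_]; [_,_]′)
open import Data.Vec using (_∷_; lookup; _[_]≔_)
open import Data.Vec.Properties using (lookup∘update; lookup∘update′; lookup-replicate)
open import Function using (_∘_; id)
open import Induction.WellFounded using (Acc; acc)
open import Relation.Binary.PropositionalEquality
  using (_≡_; _≢_; refl; sym; trans; cong; cong₂; subst; subst₂; ≢-sym; module ≡-Reasoning)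
open import Relation.Nullary using (¬_; Dec; yes; no; does; _⊎-dec_; _×-dec_; ¬?)
open import Relation.Nullary.Decidable using (decidable-stable)
open import Relation.Unary using (Decidable)

k+[k⊔[ℓ∸c]]≤k⊔ℓ : ∀ {k c ℓ} → k ≤ c → k + k ≤ suc c → c < ℓ → k + (k ⊔ (ℓ ∸ c)) ≤ k ⊔ ℓ
k+[k⊔[ℓ∸c]]≤k⊔ℓ {k} {c} {ℓ} k≤c k+k≤1+c c<ℓ = begin
  k + (k ⊔ (ℓ ∸ c))        ≡⟨ +-distribˡ-⊔ k k (ℓ ∸ c) ⟩
  (k + k) ⊔ (k + (ℓ ∸ c))  ≤⟨ ⊔-lub (≤-trans k+k≤1+c c<ℓ)
                                     (≤-trans (+-monoˡ-≤ (ℓ ∸ c) k≤c) (≤-reflexive (m+[n∸m]≡n (<⇒≤ c<ℓ)))) ⟩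
  ℓ                        ≤⟨ m≤n⊔m k ℓ ⟩
  k ⊔ ℓ                    ∎
  where open ≤-Reasoning

balanced-step : ∀ {ℓ D σ d} → 0 < d → ℓ + D ≤ suc σ → suc ℓ + D ≤ suc (d + σ)
balanced-step {σ = σ} 0<d balanced = s≤s (≤-trans balanced (+-monoˡ-≤ σ 0<d))

compact-step : ∀ {ℓ D σ d k} → d ≤ D → ℓ + D ≤ suc σ → σ < k → suc ℓ + (d + σ) ≤ k + k
compact-step {ℓ} {D} {σ} {d} {k} d≤D balanced σ<k = begin
  suc ℓ + (d + σ)    ≤⟨ s≤s (+-monoʳ-≤ ℓ (+-monoˡ-≤ σ d≤D)) ⟩
  suc (ℓ + (D + σ))  ≡⟨ cong suc (sym (+-assoc ℓ D σ)) ⟩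
  suc (ℓ + D + σ)    ≤⟨ s≤s (+-monoˡ-≤ σ balanced) ⟩
  suc (suc σ + σ)    ≡⟨ cong suc (sym (+-suc σ σ)) ⟩
  suc σ + suc σ      ≤⟨ +-mono-≤ σ<k σ<k ⟩
  k + k              ∎
  where open ≤-Reasoning

1+d+d*D≤d*[2+D] : ∀ {d D} → 0 < d → suc (d + d * D) ≤ d * suc (suc D)
1+d+d*D≤d*[2+D] {d} {D} 0<d = begin
  suc (d + d * D)        ≤⟨ +-monoˡ-≤ (d + d * D) 0<d ⟩
  d + (d + d * D)        ≡⟨ cong (d +_) (*-suc d D) ⟨
  d + d * suc D          ≡⟨ *-suc d (suc D) ⟨
  d * suc (suc D)        ∎
  where open ≤-Reasoning

⌊n/2⌋+⌊n/2⌋≤n : ∀ n → ⌊ n /2⌋ + ⌊ n /2⌋ ≤ n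
⌊n/2⌋+⌊n/2⌋≤n n = ≤-trans (+-monoʳ-≤ ⌊ n /2⌋ (⌊n/2⌋≤⌈n/2⌉ n)) (≤-reflexive (⌊n/2⌋+⌈n/2⌉≡n n))

2k[1+k]≤p*p : ∀ {k p} → 0 < k → k + k ≤ p → 2 * (k * suc k) ≤ p * p
2k[1+k]≤p*p {k} {p} 0<k k+k≤p = begin
  2 * (k * suc k)    ≡⟨ *-assoc 2 k (suc k) ⟨
  2 * k * suc k      ≡⟨ cong (λ k′ → (k + k′) * suc k) (+-identityʳ k) ⟩
  (k + k) * suc k    ≤⟨ *-mono-≤ k+k≤p (≤-trans (+-monoˡ-≤ k 0<k) k+k≤p) ⟩
  p * p              ∎
  where open ≤-Reasoning

ceilDiv-bound : ∀ h {M L B} → suc h * L ≤ M + suc h * B → L ≤ ceilDiv M (suc h) + B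
ceilDiv-bound h {M} {L} {B} hyp = begin
  L                        ≤⟨ m≤n+m∸n L B ⟩
  B + (L ∸ B)              ≤⟨ +-monoʳ-≤ B quotient ⟩
  B + (M + h) / suc h      ≡⟨ +-comm B _ ⟩
  (M + h) / suc h + B      ∎
  where
    open ≤-Reasoning
    k[L∸B]≤M : suc h * (L ∸ B) ≤ M
    k[L∸B]≤M = begin
      suc h * (L ∸ B)            ≡⟨ *-distribˡ-∸ (suc h) L B ⟩
      suc h * L ∸ suc h * B      ≤⟨ ∸-monoˡ-≤ (suc h * B) hyp ⟩
      M + suc h * B ∸ suc h * B  ≡⟨ m+n∸n≡m M (suc h * B) ⟩
      M                          ∎
    quotient : L ∸ B ≤ (M + h) / suc h
    quotient = begin
      L ∸ B                      ≡⟨ m*n/n≡m (L ∸ B) (suc h) ⟨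
      (L ∸ B) * suc h / suc h    ≤⟨ /-monoˡ-≤ (suc h) (≤-trans (≤-reflexive (*-comm (L ∸ B) (suc h)))
                                                                (≤-trans k[L∸B]≤M (m≤m+n M h))) ⟩
      (M + h) / suc h            ∎

length-bound : ∀ q {M L} → let k = suc ⌊ q /2⌋ in k * L ≤ M + k * (k * suc k) →
               2 * L ≤ 2 * ceilDiv M k + suc (suc q) * suc (suc q)
length-bound q {M} {L} kL≤ = begin
  2 * L                                   ≤⟨ *-monoʳ-≤ 2 (ceilDiv-bound ⌊ q /2⌋ {M} kL≤) ⟩
  2 * (ceilDiv M k + k * suc k)           ≡⟨ *-distribˡ-+ 2 (ceilDiv M k) (k * suc k) ⟩
  2 * ceilDiv M k + 2 * (k * suc k)       ≤⟨ +-monoʳ-≤ (2 * ceilDiv M k) (2k[1+k]≤p*p (s≤s z≤n) (⌊n/2⌋+⌊n/2⌋≤n p)) ⟩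
  2 * ceilDiv M k + p * p                 ∎
  where
    open ≤-Reasoning
    p = suc (suc q)
    k = ⌊ p /2⌋

module _ {A : Set} {P Q R : A → Set} (P? : Decidable P) (Q? : Decidable Q) (R? : Decidable R) where

  length-filter-split : (∀ {x} → P x → Q x ⊎ R x) → (∀ {x} → Q x → P x) → (∀ {x} → R x → P x) →
                        (∀ {x} → Q x → ¬ R x) → ∀ xs →
                        length (filter P? xs) ≡ length (filter Q? xs) + length (filter R? xs)
  length-filter-split P⇒Q⊎R Q⇒P R⇒P Q⇒¬R [] = refl
  length-filter-split P⇒Q⊎R Q⇒P R⇒P Q⇒¬R (x ∷ xs) with P? x | Q? x | R? x
  ... | _     | yes q | yes r = ⊥-elim (Q⇒¬R q r)
  ... | yes _ | yes _ | no _  = cong suc (length-filter-split P⇒Q⊎R Q⇒P R⇒P Q⇒¬R xs)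
  ... | yes _ | no _  | yes _ = trans (cong suc (length-filter-split P⇒Q⊎R Q⇒P R⇒P Q⇒¬R xs)) (sym (+-suc _ _))
  ... | yes p | no ¬q | no ¬r = ⊥-elim ([ ¬q , ¬r ] (P⇒Q⊎R p))
  ... | no ¬p | yes q | no _  = ⊥-elim (¬p (Q⇒P q))
  ... | no ¬p | no _  | yes r = ⊥-elim (¬p (R⇒P r))
  ... | no _  | no _  | no _  = length-filter-split P⇒Q⊎R Q⇒P R⇒P Q⇒¬R xs

module _ {A : Set} {P Q : A → Set} (P? : Decidable P) (Q? : Decidable Q) where

  length-filter-mono : (∀ {x} → P x → Q x) → ∀ xs → length (filter P? xs) ≤ length (filter Q? xs)
  length-filter-mono P⇒Q [] = z≤n
  length-filter-mono P⇒Q (x ∷ xs) with P? x | Q? x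
  ... | yes _ | yes _ = s≤s (length-filter-mono P⇒Q xs)
  ... | yes p | no ¬q = ⊥-elim (¬q (P⇒Q p))
  ... | no _  | yes _ = m≤n⇒m≤1+n (length-filter-mono P⇒Q xs)
  ... | no _  | no _  = length-filter-mono P⇒Q xs

module _ {A : Set} where

  nonempty⇒∈ : {xs : List A} → 0 < length xs → ∃ (_∈ xs)
  nonempty⇒∈ {x ∷ _} _ = x , here refl

  unique-++-disjoint : ∀ {x} xs {ys : List A} → Unique (xs ++ ys) → x ∈ xs → x ∉ ys
  unique-++-disjoint (_ ∷ xs) (x∉ ∷ _)  (here refl) x∈ys = All.lookup x∉ (∈-++⁺ʳ xs x∈ys) refl
  unique-++-disjoint (_ ∷ xs) (_ ∷ uniq) (there x∈xs) = unique-++-disjoint xs uniq x∈xs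

  allPairs-∈ : ∀ {R : A → A → Set} → (∀ {x y} → R x y → R y x) →
               ∀ {xs x y} → AllPairs R xs → x ∈ xs → y ∈ xs → x ≢ y → R x y
  allPairs-∈ R-sym (_ ∷ _)   (here refl) (here refl) x≢y = ⊥-elim (x≢y refl)
  allPairs-∈ R-sym (rs ∷ _)  (here refl) (there y∈)  _   = All.lookup rs y∈
  allPairs-∈ R-sym (rs ∷ _)  (there x∈)  (here refl) _   = R-sym (All.lookup rs x∈)
  allPairs-∈ R-sym (_ ∷ rss) (there x∈)  (there y∈)  x≢y = allPairs-∈ R-sym rss x∈ y∈ x≢y

  length≡0⇒∉ : ∀ {x} {xs : List A} → length xs ≡ 0 → x ∉ xs
  length≡0⇒∉ {xs = []} _ ()

  ∈-take⁻ : ∀ j {x} {xs : List A} → x ∈ take j xs → x ∈ xs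
  ∈-take⁻ j {xs = xs} x∈ = subst (_ ∈_) (take++drop≡id j xs) (∈-++⁺ˡ x∈)

  ∈-drop⁻ : ∀ j {x} {xs : List A} → x ∈ drop j xs → x ∈ xs
  ∈-drop⁻ j {xs = xs} x∈ = subst (_ ∈_) (take++drop≡id j xs) (∈-++⁺ʳ (take j xs) x∈)

  length-concatMap-≤ : {B : Set} (f : A → List B) {b : ℕ} → (∀ x → length (f x) ≤ b) →
                       ∀ xs → length (concatMap f xs) ≤ length xs * b
  length-concatMap-≤ f     f≤b []       = z≤n
  length-concatMap-≤ f {b} f≤b (x ∷ xs) = begin
    length (f x ++ concatMap f xs)          ≡⟨ length-++ (f x) ⟩
    length (f x) + length (concatMap f xs)  ≤⟨ +-mono-≤ (f≤b x) (length-concatMap-≤ f f≤b xs) ⟩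
    b + length xs * b                       ∎
    where open ≤-Reasoning

∣X[x]≔true∣≤1+∣X∣ : ∀ {n} (X : Subset n) x → ∣ X [ x ]≔ true ∣ ≤ suc ∣ X ∣
∣X[x]≔true∣≤1+∣X∣ (true  ∷ X) zero    = n≤1+n _
∣X[x]≔true∣≤1+∣X∣ (false ∷ X) zero    = ≤-refl
∣X[x]≔true∣≤1+∣X∣ (true  ∷ X) (suc x) = s≤s (∣X[x]≔true∣≤1+∣X∣ X x)
∣X[x]≔true∣≤1+∣X∣ (false ∷ X) (suc x) = ∣X[x]≔true∣≤1+∣X∣ X x

module _ {n : ℕ} where

  fromList : List (Fin n) → Subset n
  fromList = foldr (λ x X → X [ x ]≔ true) ∅

  lookup-fromList⁺ : ∀ {u xs} → u ∈ xs → lookup (fromList xs) u ≡ true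
  lookup-fromList⁺ {xs = x ∷ xs} (here refl) = lookup∘update x (fromList xs) true
  lookup-fromList⁺ {u} {x ∷ xs} (there u∈xs) with x ≟ u
  ... | yes refl = lookup∘update x (fromList xs) true
  ... | no x≢u   = trans (lookup∘update′ (≢-sym x≢u) (fromList xs) true) (lookup-fromList⁺ u∈xs)

  lookup-fromList⁻ : ∀ {u} xs → lookup (fromList xs) u ≡ true → u ∈ xs
  lookup-fromList⁻ {u} []       eq with () ← trans (sym eq) (lookup-replicate u false)
  lookup-fromList⁻ {u} (x ∷ xs) eq with x ≟ u
  ... | yes refl = here refl
  ... | no x≢u   = there (lookup-fromList⁻ xs (trans (sym (lookup∘update′ (≢-sym x≢u) (fromList xs) true)) eq))

  ∣fromList∣≤length : ∀ xs → ∣ fromList xs ∣ ≤ length xs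
  ∣fromList∣≤length []       = ≤-reflexive (∣⊥∣≡0 n)
  ∣fromList∣≤length (x ∷ xs) = ≤-trans (∣X[x]≔true∣≤1+∣X∣ (fromList xs) x) (s≤s (∣fromList∣≤length xs))

module _ (G : Graph) where

  V E : Set
  V = Fin (n G)
  E = Fin (m G)

  end₁ end₂ : E → V
  end₁ e = proj₁ (ends G e)
  end₂ e = proj₂ (ends G e)

  Touches : V → E → Set
  Touches v e = end₁ e ≡ v ⊎ end₂ e ≡ v

  touches? : ∀ v → Decidable (Touches v)
  touches? v e = (end₁ e ≟ v) ⊎-dec (end₂ e ≟ v)

  other : V → E → V
  other v e = if does (end₁ e ≟ v) then end₂ e else end₁ e

  touches-ends : ∀ {v e} → Touches v e →
                 (end₁ e ≡ v × other v e ≡ end₂ e) ⊎ (end₂ e ≡ v × other v e ≡ end₁ e)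
  touches-ends {v} {e} t with end₁ e ≟ v | t
  ... | yes e₁≡v | _        = inj₁ (e₁≡v , refl)
  ... | no e₁≢v  | inj₁ e₁≡v = ⊥-elim (e₁≢v e₁≡v)
  ... | no _     | inj₂ e₂≡v = inj₂ (e₂≡v , refl)

  end₁≢end₂ : ∀ e → end₁ e ≢ end₂ e
  end₁≢end₂ e eq = <⇒≢ (ordered G e) (cong toℕ eq)

  not-reversed : ∀ {e f} → end₁ e ≡ end₂ f → end₂ e ≡ end₁ f → ⊥
  not-reversed {e} {f} e₁≡f₂ e₂≡f₁ =
    <-asym (ordered G e) (subst₂ (λ x y → toℕ x < toℕ y) (sym e₂≡f₁) (sym e₁≡f₂) (ordered G f))

  other-≢ : ∀ {v e} → Touches v e → other v e ≢ v
  other-≢ {v} {e} t with touches-ends t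
  ... | inj₁ (e₁≡v , o≡e₂) = λ o≡v → end₁≢end₂ e (trans e₁≡v (trans (sym o≡v) o≡e₂))
  ... | inj₂ (e₂≡v , o≡e₁) = λ o≡v → end₁≢end₂ e (trans (sym o≡e₁) (trans o≡v (sym e₂≡v)))

  touches-other : ∀ {v e} → Touches v e → Touches (other v e) e
  touches-other t with touches-ends t
  ... | inj₁ (_ , o≡e₂) = inj₂ (sym o≡e₂)
  ... | inj₂ (_ , o≡e₁) = inj₁ (sym o≡e₁)

  touching-both : ∀ {u v e} → Touches v e → Touches u e → u ≢ v → u ≡ other v e
  touching-both tv tu u≢v with touches-ends tv | tu
  ... | inj₁ (e₁≡v , _)    | inj₁ e₁≡u = ⊥-elim (u≢v (trans (sym e₁≡u) e₁≡v))
  ... | inj₁ (_ , o≡e₂)    | inj₂ e₂≡u = trans (sym e₂≡u) (sym o≡e₂)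
  ... | inj₂ (_ , o≡e₁)    | inj₁ e₁≡u = trans (sym e₁≡u) (sym o≡e₁)
  ... | inj₂ (e₂≡v , _)    | inj₂ e₂≡u = ⊥-elim (u≢v (trans (sym e₂≡u) e₂≡v))

  other-other : ∀ {v e} → Touches v e → other (other v e) e ≡ v
  other-other {v} {e} t =
    sym (touching-both (touches-other t) t (λ v≡o → other-≢ t (sym v≡o)))

  other-injective : ∀ {v e f} → Touches v e → Touches v f → other v e ≡ other v f → e ≡ f
  other-injective {v} {e} {f} te tf oe≡of with touches-ends te | touches-ends tf
  ... | inj₁ (e₁≡v , oe≡e₂) | inj₁ (f₁≡v , of≡f₂) =
    simple G e f (cong₂ _,_ (trans e₁≡v (sym f₁≡v)) (trans (sym oe≡e₂) (trans oe≡of of≡f₂)))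
  ... | inj₂ (e₂≡v , oe≡e₁) | inj₂ (f₂≡v , of≡f₁) =
    simple G e f (cong₂ _,_ (trans (sym oe≡e₁) (trans oe≡of of≡f₁)) (trans e₂≡v (sym f₂≡v)))
  ... | inj₁ (e₁≡v , oe≡e₂) | inj₂ (f₂≡v , of≡f₁) =
    ⊥-elim (not-reversed (trans e₁≡v (sym f₂≡v)) (trans (sym oe≡e₂) (trans oe≡of of≡f₁)))
  ... | inj₂ (e₂≡v , oe≡e₁) | inj₁ (f₁≡v , of≡f₂) =
    ⊥-elim (not-reversed (trans (sym oe≡e₁) (trans oe≡of of≡f₂)) (trans e₂≡v (sym f₁≡v)))

  ends∈ : ∀ {v e xs} → Touches v e → v ∈ xs → other v e ∈ xs → end₁ e ∈ xs × end₂ e ∈ xs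
  ends∈ {xs = xs} t v∈ o∈ with touches-ends t
  ... | inj₁ (e₁≡v , o≡e₂) = subst (_∈ xs) (sym e₁≡v) v∈ , subst (_∈ xs) o≡e₂ o∈
  ... | inj₂ (e₂≡v , o≡e₁) = subst (_∈ xs) o≡e₁ o∈ , subst (_∈ xs) (sym e₂≡v) v∈

  other∈ : ∀ {v e xs} → Touches v e → end₁ e ∈ xs × end₂ e ∈ xs → other v e ∈ xs
  other∈ {xs = xs} t (e₁∈ , e₂∈) with touches-ends t
  ... | inj₁ (_ , o≡e₂) = subst (_∈ xs) (sym o≡e₂) e₂∈
  ... | inj₂ (_ , o≡e₁) = subst (_∈ xs) (sym o≡e₁) e₁∈

  -- The graph G − S

  open import Data.List.Membership.DecPropositional (_≟_ {n G}) using (_∈?_)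
  open import Data.List.Membership.DecPropositional (_≟_ {m G}) using () renaming (_∈?_ to _∈ₑ?_)

  Avoids : List V → E → Set
  Avoids S e = end₁ e ∉ S × end₂ e ∉ S

  avoids? : ∀ S → Decidable (Avoids S)
  avoids? S e = ¬? (end₁ e ∈? S) ×-dec ¬? (end₂ e ∈? S)

  Incident : List V → V → E → Set
  Incident S v e = Avoids S e × Touches v e

  incident? : ∀ S v → Decidable (Incident S v)
  incident? S v e = avoids? S e ×-dec touches? v e

  avoiding : List V → List E
  avoiding S = filter (avoids? S) (allFin (m G))

  size : List V → ℕ
  size S = length (avoiding S)

  star : List V → V → List E
  star S v = filter (incident? S v) (allFin (m G))

  deg : List V → V → ℕ
  deg S v = length (star S v)

  nbrs : List V → V → List V
  nbrs S v = map (other v) (star S v)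

  ∉-++ : ∀ {x} {T S : List V} → x ∉ T → x ∉ S → x ∉ T ++ S
  ∉-++ {T = T} x∉T x∉S x∈ = [ x∉T , x∉S ] (∈-++⁻ T x∈)

  avoids-++ : ∀ T {S e} → Avoids (T ++ S) e → Avoids S e
  avoids-++ T (e₁∉ , e₂∉) = e₁∉ ∘ ∈-++⁺ʳ T , e₂∉ ∘ ∈-++⁺ʳ T

  size≤m : ∀ S → size S ≤ m G
  size≤m S = ≤-trans (length-filter (avoids? S) (allFin (m G))) (≤-reflexive (length-tabulate id))

  ∈-star : ∀ {S v e} → Incident S v e → e ∈ star S v
  ∈-star {S} {v} {e} inc = ∈-filter⁺ (incident? S v) (∈-allFin e) inc

  ∈-star⁻ : ∀ {S v e} → e ∈ star S v → Incident S v e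
  ∈-star⁻ {S} {v} e∈ = proj₂ (∈-filter⁻ (incident? S v) {xs = allFin (m G)} e∈)

  ∈-nbrs : ∀ {S v e} → Incident S v e → other v e ∈ nbrs S v
  ∈-nbrs inc = ∈-map⁺ (other _) (∈-star inc)

  other-∉ : ∀ {S v e} → Incident S v e → other v e ∉ S
  other-∉ ((e₁∉ , e₂∉) , t) with touches-ends t
  ... | inj₁ (_ , o≡e₂) = subst (_∉ _) (sym o≡e₂) e₂∉
  ... | inj₂ (_ , o≡e₁) = subst (_∉ _) (sym o≡e₁) e₁∉

  self-∉ : ∀ {S v e} → Incident S v e → v ∉ S
  self-∉ ((e₁∉ , e₂∉) , inj₁ e₁≡v) = subst (_∉ _) e₁≡v e₁∉
  self-∉ ((e₁∉ , e₂∉) , inj₂ e₂≡v) = subst (_∉ _) e₂≡v e₂∉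

  incident⇒0<deg : ∀ {S v e} → Incident S v e → 0 < deg S v
  incident⇒0<deg {S} {v} {e} inc = filter-some (incident? S v) (lose (∈-allFin e) inc)

  0<deg⇒incident : ∀ {S v} → 0 < deg S v → ∃ (Incident S v)
  0<deg⇒incident 0<d with nonempty⇒∈ 0<d
  ... | e , e∈ = e , ∈-star⁻ e∈

  0<deg⇒∉ : ∀ {S v} → 0 < deg S v → v ∉ S
  0<deg⇒∉ = self-∉ ∘ proj₂ ∘ 0<deg⇒incident

  size-split : ∀ S v → size S ≡ size (v ∷ S) + deg S v
  size-split S v = length-filter-split (avoids? S) (avoids? (v ∷ S)) (incident? S v)
    split (avoids-++ (v ∷ [])) proj₁ (λ (e₁∉ , e₂∉) (_ , t) → [ e₁∉ ∘ here , e₂∉ ∘ here ]′ t) (allFin (m G))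
    where
      split : ∀ {e} → Avoids S e → Avoids (v ∷ S) e ⊎ Incident S v e
      split {e} av@(e₁∉ , e₂∉) with touches? v e
      ... | yes t = inj₂ (av , t)
      ... | no ¬t = inj₁ (∉-∷ (¬t ∘ inj₁ ∘ sym) e₁∉ , ∉-∷ (¬t ∘ inj₂ ∘ sym) e₂∉)
        where ∉-∷ : ∀ {x} → v ≢ x → x ∉ S → x ∉ v ∷ S
              ∉-∷ v≢x x∉S (here x≡v) = v≢x (sym x≡v)
              ∉-∷ v≢x x∉S (there x∈S) = x∉S x∈S

  deg-++ : ∀ T S v → deg (T ++ S) v ≤ deg S v
  deg-++ T S v = length-filter-mono (incident? (T ++ S) v) (incident? S v)
    (λ (av , t) → avoids-++ T av , t) (allFin (m G))

  deg-unaffected : ∀ T S v → (∀ {e} → Incident S v e → Avoids T e) → deg (T ++ S) v ≡ deg S v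
  deg-unaffected T S v avoidsT = cong length (filter-≐ (incident? (T ++ S) v) (incident? S v)
    ((λ (av , t) → avoids-++ T av , t) ,
     (λ inc@((e₁∉S , e₂∉S) , t) → (∉-++ (proj₁ (avoidsT inc)) e₁∉S , ∉-++ (proj₂ (avoidsT inc)) e₂∉S) , t))
    (allFin (m G)))

  avoids-from : ∀ {T v e} → Touches v e → v ∉ T → other v e ∉ T → Avoids T e
  avoids-from {T} t v∉ o∉ with touches-ends t
  ... | inj₁ (e₁≡v , o≡e₂) = subst (_∉ T) (sym e₁≡v) v∉ , subst (_∉ T) o≡e₂ o∉
  ... | inj₂ (e₂≡v , o≡e₁) = subst (_∉ T) o≡e₁ o∉ , subst (_∉ T) (sym e₂≡v) v∉

  flipped : Subset (n G) → E → Bool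
  flipped X e = lookup X (end₁ e) ∧ lookup X (end₂ e)

  invert-inside : ∀ {o xs e} → end₁ e ∈ xs → end₂ e ∈ xs → invert G o (fromList xs) e ≡ not (o e)
  invert-inside {o} {xs} {e} e₁∈ e₂∈ =
    cong (λ b → if b then not (o e) else o e) (cong₂ _∧_ (lookup-fromList⁺ e₁∈) (lookup-fromList⁺ e₂∈))

  invert-outside : ∀ {o xs e} → ¬ (end₁ e ∈ xs × end₂ e ∈ xs) → invert G o (fromList xs) e ≡ o e
  invert-outside {o} {xs} {e} ¬both = by-flip (flipped (fromList xs) e) refl
    where
      by-flip : ∀ b → flipped (fromList xs) e ≡ b → (if b then not (o e) else o e) ≡ o e
      by-flip false _  = refl
      by-flip true  eq with lookup (fromList xs) (end₁ e) in eq₁ | eq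
      ... | true | eq₂ = ⊥-elim (¬both (lookup-fromList⁻ xs eq₁ , lookup-fromList⁻ xs eq₂))

  -- Scattered vertex sets

  record Separated (S : List V) (z u : V) : Set where
    field
      distinct      : z ≢ u
      nonadjacent   : ∀ {e} → Incident S z e → ¬ Touches u e
      no-common-nbr : ∀ {e f} → Incident S z e → Incident S u f → other z e ≢ other u f

  separated-sym : ∀ {S z u} → Separated S z u → Separated S u z
  separated-sym sep = record
    { distinct      = ≢-sym distinct
    ; nonadjacent   = λ (av , tu) tz → nonadjacent (av , tz) tu
    ; no-common-nbr = λ inc-u inc-z eq → no-common-nbr inc-z inc-u (sym eq)
    }
    where open Separated sep

  Scattered : List V → List V → Set
  Scattered S = AllPairs (Separated S)

  ball : List V → V → List V
  ball S z = z ∷ nbrs S z ++ concatMap (nbrs S) (nbrs S z)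

  ∉ball⇒separated : ∀ {S z u} → u ∉ ball S z → Separated S z u
  ∉ball⇒separated {S} {z} {u} u∉ = record
    { distinct      = λ z≡u → u∉ (here (sym z≡u))
    ; nonadjacent   = λ inc tu → u∉ (there (∈-++⁺ˡ (subst (_∈ nbrs S z)
                        (sym (touching-both (proj₂ inc) tu (λ u≡z → u∉ (here u≡z)))) (∈-nbrs inc))))
    ; no-common-nbr = common
    }
    where
      common : ∀ {e f} → Incident S z e → Incident S u f → other z e ≢ other u f
      common {e} {f} inc-z (av , tu) w≡ = u∉ (there (∈-++⁺ʳ (nbrs S z)
        (∈-concatMap⁺ (nbrs S) (lose (∈-nbrs inc-z) (subst (_∈ nbrs S (other z e)) u≡ (∈-nbrs inc-w))))))
        where
          inc-w : Incident S (other z e) f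
          inc-w = av , subst (λ w → Touches w f) (sym w≡) (touches-other tu)
          u≡ : other (other z e) f ≡ u
          u≡ = trans (cong (λ w → other w f) w≡) (other-other tu)

  spokes : (V → List E) → V → List V
  spokes C z = z ∷ map (other z) (C z)

  cluster : List V → (V → List E) → List V
  cluster Z C = concatMap (spokes C) Z

  length-cluster : ∀ {C f} → (∀ z → length (C z) ≤ f z) → ∀ Z → length (cluster Z C) ≤ length Z + sum (map f Z)
  length-cluster         C≤f []      = z≤n
  length-cluster {C} {f} C≤f (z ∷ Z) = s≤s (begin
    length (map (other z) (C z) ++ cluster Z C)         ≡⟨ length-++ (map (other z) (C z)) ⟩
    length (map (other z) (C z)) + length (cluster Z C) ≡⟨ cong (_+ length (cluster Z C)) (length-map (other z) (C z)) ⟩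
    length (C z) + length (cluster Z C)                 ≤⟨ +-mono-≤ (C≤f z) (length-cluster C≤f Z) ⟩
    f z + (length Z + sum (map f Z))                    ≡⟨ x∙yz≈y∙xz (f z) (length Z) _ ⟩
    length Z + (f z + sum (map f Z))                    ∎)
    where open ≤-Reasoning

  module _ {S Z : List V} {C : V → List E} (Z∉S : All (_∉ S) Z) (C-inc : ∀ {z e} → z ∈ Z → e ∈ C z → Incident S z e)
           (scattered : Scattered S Z) where

    cluster-∉ : ∀ {u} → u ∈ cluster Z C → u ∉ S
    cluster-∉ u∈ with find (∈-concatMap⁻ (spokes C) {xs = Z} u∈)
    ... | z , z∈ , here refl = All.lookup Z∉S z∈
    ... | z , z∈ , there u∈map with ∈-map⁻ (other z) u∈map
    ...   | f , f∈ , refl = other-∉ (C-inc z∈ f∈)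

    center∈cluster : ∀ {z} → z ∈ Z → z ∈ cluster Z C
    center∈cluster z∈ = ∈-concatMap⁺ (spokes C) (lose z∈ (here refl))

    other∈cluster : ∀ {z e} → z ∈ Z → e ∈ C z → other z e ∈ cluster Z C
    other∈cluster {z} z∈ e∈ = ∈-concatMap⁺ (spokes C) (lose z∈ (there (∈-map⁺ (other z) e∈)))

    other∈cluster⁻ : ∀ {z e} → z ∈ Z → Incident S z e → other z e ∈ cluster Z C → e ∈ C z
    other∈cluster⁻ {z} {e} z∈ inc o∈ with find (∈-concatMap⁻ (spokes C) {xs = Z} o∈)
    ... | z′ , z′∈ , o∈z′ with z ≟ z′
    ...   | no z≢z′ = ⊥-elim (from-elsewhere o∈z′)
      where
        open Separated (allPairs-∈ separated-sym scattered z∈ z′∈ z≢z′)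
        from-elsewhere : other z e ∉ z′ ∷ map (other z′) (C z′)
        from-elsewhere (here o≡z′) = nonadjacent inc (subst (λ w → Touches w e) o≡z′ (touches-other (proj₂ inc)))
        from-elsewhere (there o∈map) with ∈-map⁻ (other z′) o∈map
        ... | f , f∈ , o≡ = no-common-nbr inc (C-inc z′∈ f∈) o≡
    ...   | yes refl with o∈z′
    ...     | here o≡z = ⊥-elim (other-≢ (proj₂ inc) o≡z)
    ...     | there o∈map with ∈-map⁻ (other z) o∈map
    ...       | f , f∈ , o≡ = subst (_∈ C z) (sym (other-injective (proj₂ inc) (proj₂ (C-inc z∈ f∈)) o≡)) f∈

    module _ {o : Orientation G} {z : V} {e : E} (z∈ : z ∈ Z) (inc : Incident S z e) where

      cluster-flips : e ∈ C z → invert G o (fromList (cluster Z C)) e ≡ not (o e)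
      cluster-flips e∈ = uncurry (invert-inside {o}) (ends∈ (proj₂ inc) (center∈cluster z∈) (other∈cluster z∈ e∈))

      cluster-keeps : e ∉ C z → invert G o (fromList (cluster Z C)) e ≡ o e
      cluster-keeps e∉ = invert-outside {o} (λ both → e∉ (other∈cluster⁻ z∈ inc (other∈ (proj₂ inc) both)))

  degSum : List V → List V → ℕ
  degSum S Z = sum (map (deg S) Z)

  size-scattered : ∀ {S} Z → Scattered S Z → size (Z ++ S) + degSum S Z ≡ size S
  size-scattered     []      _                   = +-identityʳ _
  size-scattered {S} (z ∷ Z) (sep-z ∷ scattered) = begin
    size (z ∷ Z ++ S) + (deg S z + degSum S Z)          ≡⟨ cong (λ d → size (z ∷ Z ++ S) + (d + degSum S Z)) (sym deg-same) ⟩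
    size (z ∷ Z ++ S) + (deg (Z ++ S) z + degSum S Z)   ≡⟨ sym (+-assoc (size (z ∷ Z ++ S)) _ _) ⟩
    size (z ∷ Z ++ S) + deg (Z ++ S) z + degSum S Z     ≡⟨ cong (_+ degSum S Z) (sym (size-split (Z ++ S) z)) ⟩
    size (Z ++ S) + degSum S Z                          ≡⟨ size-scattered Z scattered ⟩
    size S                                              ∎
    where
      open ≡-Reasoning
      deg-same : deg (Z ++ S) z ≡ deg S z
      deg-same = deg-unaffected Z S z λ inc →
        avoids-from (proj₂ inc)
          (λ z∈ → Separated.distinct (All.lookup sep-z z∈) refl)
          (λ o∈ → Separated.nonadjacent (All.lookup sep-z o∈) inc (touches-other (proj₂ inc)))

  cover : List V → List V → List V
  cover S Z = concatMap (ball S) Z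

  ∉cover⇒separated : ∀ {S Z u} → u ∉ cover S Z → All (λ z → Separated S z u) Z
  ∉cover⇒separated {S} u∉ = All.tabulate λ z∈ → ∉ball⇒separated λ u∈ball → u∉ (∈-concatMap⁺ (ball S) (lose z∈ u∈ball))

  length-ball : ∀ {S D z} → (∀ u → deg S u ≤ D) → 0 < deg S z → length (ball S z) ≤ deg S z * suc (suc D)
  length-ball {S} {D} {z} deg≤D pos = begin
    suc (length (nbrs S z ++ concatMap (nbrs S) (nbrs S z)))            ≡⟨ cong suc (length-++ (nbrs S z)) ⟩
    suc (length (nbrs S z) + length (concatMap (nbrs S) (nbrs S z)))    ≤⟨ s≤s (+-monoʳ-≤ (length (nbrs S z))
                                                                            (length-concatMap-≤ (nbrs S) nbrs≤D (nbrs S z))) ⟩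
    suc (length (nbrs S z) + length (nbrs S z) * D)                     ≡⟨ cong (λ d → suc (d + d * D)) (length-map (other z) (star S z)) ⟩
    suc (deg S z + deg S z * D)                                         ≤⟨ 1+d+d*D≤d*[2+D] pos ⟩
    deg S z * suc (suc D)                                               ∎
    where
      open ≤-Reasoning
      nbrs≤D : ∀ w → length (nbrs S w) ≤ D
      nbrs≤D w = ≤-trans (≤-reflexive (length-map (other w) (star S w))) (deg≤D w)

  length-cover : ∀ {S D Z} → (∀ u → deg S u ≤ D) → All (λ z → 0 < deg S z) Z →
                 length (cover S Z) ≤ degSum S Z * suc (suc D)
  length-cover         deg≤D []               = z≤n
  length-cover {S} {D} {z ∷ Z} deg≤D (pos ∷ positive) = begin
    length (ball S z ++ cover S Z)                          ≡⟨ length-++ (ball S z) ⟩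
    length (ball S z) + length (cover S Z)                  ≤⟨ +-mono-≤ (length-ball deg≤D pos) (length-cover deg≤D positive) ⟩
    deg S z * suc (suc D) + degSum S Z * suc (suc D)        ≡⟨ *-distribʳ-+ (suc (suc D)) (deg S z) (degSum S Z) ⟨
    (deg S z + degSum S Z) * suc (suc D)                    ∎
    where open ≤-Reasoning

  record Heavy (k : ℕ) (S Z : List V) : Set where
    field
      scattered : Scattered S Z
      positive  : All (λ z → 0 < deg S z) Z
      compact   : length Z + degSum S Z ≤ k + k
      heavy     : k ≤ degSum S Z

  record Covering (k : ℕ) (S Z₀ us : List V) : Set where
    field
      Z        : List V
      positive : All (λ z → 0 < deg S z) Z
      light    : degSum S Z < k
      extends  : ∀ {u} → u ∈ cover S Z₀ → u ∈ cover S Z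
      covers   : ∀ {u} → u ∈ us → 0 < deg S u → u ∈ cover S Z

  module Gather (k : ℕ) {S : List V} {D : ℕ} (deg≤D : ∀ u → deg S u ≤ D) where

    record Candidate (Z : List V) : Set where
      field
        scattered : Scattered S Z
        positive  : All (λ z → 0 < deg S z) Z
        -- Holds for Z = v ∷ [] with deg S v = D and survives adding vertices of
        -- positive degree; it is what keeps a heavy Z compact.
        balanced  : length Z + D ≤ suc (degSum S Z)
        light     : degSum S Z < k

    Outcome : List V → List V → Set
    Outcome Z us = ∃ (Heavy k S) ⊎ Covering k S Z us

    skip : ∀ {Z u us} → (0 < deg S u → u ∈ cover S Z) → Outcome Z us → Outcome Z (u ∷ us)
    skip _     (inj₁ heavy) = inj₁ heavy
    skip u-cov (inj₂ cov)   = inj₂ record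
      { Z = Z ; positive = positive ; light = light ; extends = extends
      ; covers = λ where
          (here refl) pos → extends (u-cov pos)
          (there u∈)  pos → covers u∈ pos
      }
      where open Covering cov

    add : ∀ {Z u us} → Outcome (u ∷ Z) us → Outcome Z (u ∷ us)
    add         (inj₁ heavy) = inj₁ heavy
    add {Z} {u} (inj₂ cov)   = inj₂ record
      { Z = Z′ ; positive = positive ; light = light
      ; extends = λ u∈ → extends (∈-++⁺ʳ (ball S u) u∈)
      ; covers  = λ where
          (here refl) _   → extends (∈-++⁺ˡ {xs = ball S u} (here refl))
          (there u∈)  pos → covers u∈ pos
      }
      where open Covering cov renaming (Z to Z′)

    gather : ∀ us Z → Candidate Z → Outcome Z us
    gather []       Z cand = inj₂ record
      { Z = Z ; positive = positive ; light = light ; extends = id ; covers = λ () }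
      where open Candidate cand
    gather (u ∷ us) Z cand with 0 <? deg S u
    ... | no  isolated = skip (⊥-elim ∘ isolated) (gather us Z cand)
    ... | yes pos with u ∈? cover S Z
    ...   | yes u∈cover = skip (λ _ → u∈cover) (gather us Z cand)
    ...   | no  u∉cover = grow (k ≤? deg S u + degSum S Z)
      where
        open Candidate cand
        far : All (Separated S u) Z
        far = All.map separated-sym (∉cover⇒separated u∉cover)
        grow : Dec (k ≤ deg S u + degSum S Z) → Outcome Z (u ∷ us)
        grow (yes heavy) = inj₁ (u ∷ Z , record
          { scattered = far ∷ scattered ; positive = pos ∷ positive
          ; compact = compact-step (deg≤D u) balanced light ; heavy = heavy })
        grow (no ¬heavy) = add (gather us (u ∷ Z) record
          { scattered = far ∷ scattered ; positive = pos ∷ positive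
          ; balanced = balanced-step {length Z} pos balanced ; light = ≰⇒> ¬heavy })

  -- Settled vertices

  module _ (o₂ : Orientation G) where

    Settled : List V → Orientation G → Set
    Settled S o = ∀ e → ¬ Avoids S e → o e ≡ o₂ e

    invert-settled : ∀ {S o xs} → (∀ {u} → u ∈ xs → u ∉ S) → Settled S o →
                     Settled S (invert G o (fromList xs))
    invert-settled {o = o} pending settled e ¬av =
      trans (invert-outside {o} (λ (e₁∈ , e₂∈) → ¬av (pending e₁∈ , pending e₂∈))) (settled e ¬av)

    settle : ∀ {S o} Z → Settled S o → (∀ {z e} → z ∈ Z → Incident S z e → o e ≡ o₂ e) →
             Settled (Z ++ S) o
    settle {S} Z settled fixed e ¬av with avoids? S e | end₁ e ∈? Z | end₂ e ∈? Z
    ... | no ¬avS           | _       | _       = settled e ¬avS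
    ... | yes avS           | yes e₁∈ | _       = fixed e₁∈ (avS , inj₁ refl)
    ... | yes avS           | no _    | yes e₂∈ = fixed e₂∈ (avS , inj₂ refl)
    ... | yes (e₁∉S , e₂∉S) | no e₁∉Z | no e₂∉Z = ⊥-elim (¬av (∉-++ e₁∉Z e₁∉S , ∉-++ e₂∉Z e₂∉S))

    nothing-settled : ∀ {o} → Settled [] o
    nothing-settled e ¬av = ⊥-elim (¬av ((λ ()) , (λ ())))

    settle-member : ∀ {S o u} → u ∈ S → Settled S o → Settled (u ∷ S) o
    settle-member u∈S settled = settle (_ ∷ []) settled λ where (here refl) inc → ⊥-elim (self-∉ inc u∈S)

    corrected : ∀ {o o′ : Orientation G} {e} → (o e ≢ o₂ e → o′ e ≡ not (o e)) → (o e ≡ o₂ e → o′ e ≡ o e) →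
                o′ e ≡ o₂ e
    corrected {o} {e = e} flips keeps with o e Bool.≟ o₂ e
    ... | yes right = trans (keeps right) right
    ... | no  wrong = trans (flips wrong) (sym (¬-not (≢-sym wrong)))

    -- Repairing the edges at one vertex

    wrongAt : List V → Orientation G → V → List E
    wrongAt S o v = filter (λ e → ¬? (o e Bool.≟ o₂ e)) (star S v)

    -- Inversions have at most p = 1 + c vertices, and each must pay for k ≥ 1 edges, where 2k ≤ p.
    module Strategy (c k : ℕ) .{{_ : NonZero k}} (k+k≤1+c : k + k ≤ suc c) where

      Small : Subset (n G) → Set
      Small X = ∣ X ∣ ≤ suc c

      k≤c : k ≤ c
      k≤c = ≤-pred (≤-trans (≤-reflexive (+-comm 1 k)) (≤-trans (+-monoʳ-≤ k (>-nonZero⁻¹ k)) k+k≤1+c))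

      0<c : 0 < c
      0<c = ≤-trans (>-nonZero⁻¹ k) k≤c

      module _ {S : List V} {v : V} (v∉S : v ∉ S) where

        record Misoriented (o : Orientation G) (L : List E) : Set where
          field
            unique   : Unique L
            incident : ∀ {e} → e ∈ L → Incident S v e
            wrong    : ∀ {e} → e ∈ L → o e ≢ o₂ e
            right    : ∀ {e} → Incident S v e → e ∉ L → o e ≡ o₂ e

        chunk : List E → Subset (n G)
        chunk C = fromList (cluster (v ∷ []) (λ _ → C))

        module _ {C : List E} (C-inc : ∀ {e} → e ∈ C → Incident S v e) where

          private
            inc-at-v : ∀ {z e} → z ∈ v ∷ [] → e ∈ C → Incident S z e
            inc-at-v (here refl) = C-inc

          chunk-settled : ∀ {o} → Settled S o → Settled S (invert G o (chunk C))
          chunk-settled = invert-settled (cluster-∉ (v∉S ∷ []) inc-at-v ([] ∷ []))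

          chunk-flips : ∀ {o e} → Incident S v e → e ∈ C → invert G o (chunk C) e ≡ not (o e)
          chunk-flips {o} inc = cluster-flips (v∉S ∷ []) inc-at-v ([] ∷ []) {o} (here refl) inc

          chunk-keeps : ∀ {o e} → Incident S v e → e ∉ C → invert G o (chunk C) e ≡ o e
          chunk-keeps {o} inc = cluster-keeps (v∉S ∷ []) inc-at-v ([] ∷ []) {o} (here refl) inc

        ∣chunk∣≤ : ∀ C → ∣ chunk C ∣ ≤ suc (length C)
        ∣chunk∣≤ C = ≤-trans (∣fromList∣≤length (cluster (v ∷ []) (λ _ → C))) (≤-reflexive (cong suc length-spokes))
          where
            length-spokes : length (map (other v) C ++ []) ≡ length C
            length-spokes = trans (length-++ (map (other v) C)) (trans (+-identityʳ _) (length-map (other v) C))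

        invert-chunk : ∀ j {o L} → Misoriented o L →
                       Misoriented (invert G o (chunk (take j L))) (drop j L)
        invert-chunk j {o} {L} mis = record
          { unique   = drop⁺ j unique
          ; incident = incident ∘ ∈D⇒∈L
          ; wrong    = λ {e} e∈D → subst (_≢ o₂ e) (sym (keeps (incident (∈D⇒∈L e∈D)) (C∩D e∈D)))
                                         (wrong (∈D⇒∈L e∈D))
          ; right    = fixed
          }
          where
            open Misoriented mis
            C = take j L
            D = drop j L
            C++D≡L : C ++ D ≡ L
            C++D≡L = take++drop≡id j L
            ∈C⇒∈L : ∀ {e} → e ∈ C → e ∈ L
            ∈C⇒∈L = ∈-take⁻ j
            ∈D⇒∈L : ∀ {e} → e ∈ D → e ∈ L
            ∈D⇒∈L = ∈-drop⁻ j
            C∩D : ∀ {e} → e ∈ D → e ∉ C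
            C∩D e∈D e∈C = unique-++-disjoint C (subst Unique (sym C++D≡L) unique) e∈C e∈D
            keeps : ∀ {e} → Incident S v e → e ∉ C → invert G o (chunk C) e ≡ o e
            keeps = chunk-keeps (incident ∘ ∈C⇒∈L) {o}
            fixed : ∀ {e} → Incident S v e → e ∉ D → invert G o (chunk C) e ≡ o₂ e
            fixed {e} inc e∉D with e ∈ₑ? C
            ... | yes e∈C = trans (chunk-flips (incident ∘ ∈C⇒∈L) {o} inc e∈C)
                                  (sym (¬-not (≢-sym (wrong (∈C⇒∈L e∈C)))))
            ... | no e∉C  = trans (keeps inc e∉C)
                                  (right inc λ e∈L → [ e∉C , e∉D ]′ (∈-++⁻ C (subst (_ ∈_) (sym C++D≡L) e∈L)))

        Repaired : Orientation G → ℕ → Set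
        Repaired o ℓ = ∃ λ Xs → All Small Xs × Settled (v ∷ S) (invertAll G o Xs) × k * length Xs ≤ k ⊔ ℓ

        repair-chunks : ∀ {o} L → Acc _<_ (length L) → Settled S o → Misoriented o L → Repaired o (length L)
        repair-chunks {o} L (acc rs) settled mis = by-length (length L ≤? c)
          where
            X = chunk (take c L)
            mis′ : Misoriented (invert G o X) (drop c L)
            mis′ = invert-chunk c mis
            settled′ : Settled S (invert G o X)
            settled′ = chunk-settled (Misoriented.incident mis ∘ ∈-take⁻ c) settled
            small : Small X
            small = ≤-trans (∣chunk∣≤ (take c L)) (s≤s (≤-trans (≤-reflexive (length-take c L)) (m⊓n≤m c _)))

            by-length : Dec (length L ≤ c) → Repaired o (length L)
            by-length (yes ℓ≤c) = X ∷ [] , small ∷ [] , settle (v ∷ []) settled′ repaired ,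
                                  ≤-trans (≤-reflexive (*-identityʳ k)) (m≤m⊔n k (length L))
              where
                repaired : ∀ {z e} → z ∈ v ∷ [] → Incident S z e → invert G o X e ≡ o₂ e
                repaired (here refl) inc = Misoriented.right mis′ inc
                  (length≡0⇒∉ (trans (length-drop c L) (m≤n⇒m∸n≡0 ℓ≤c)))
            by-length (no ℓ≰c) with repair-chunks (drop c L) (rs shorter) settled′ mis′
              where
                shorter : length (drop c L) < length L
                shorter = subst (_< length L) (sym (length-drop c L)) (∸-monoʳ-< 0<c (<⇒≤ (≰⇒> ℓ≰c)))
            ... | Xs , smalls , settledXs , bound = X ∷ Xs , small ∷ smalls , settledXs , (begin
              k * suc (length Xs)            ≡⟨ *-suc k (length Xs) ⟩
              k + k * length Xs              ≤⟨ +-monoʳ-≤ k bound ⟩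
              k + (k ⊔ length (drop c L))    ≡⟨ cong (λ d → k + (k ⊔ d)) (length-drop c L) ⟩
              k + (k ⊔ (length L ∸ c))       ≤⟨ k+[k⊔[ℓ∸c]]≤k⊔ℓ k≤c k+k≤1+c (≰⇒> ℓ≰c) ⟩
              k ⊔ length L                   ∎)
              where open ≤-Reasoning

        repair : ∀ {o} → Settled S o → Repaired o (deg S v)
        repair {o} settled with repair-chunks (wrongAt S o v) (<-wellFounded _) settled misoriented
          where
            misoriented : Misoriented o (wrongAt S o v)
            misoriented = record
              { unique   = filter⁺ _ (filter⁺ _ (allFin⁺ _))
              ; incident = λ e∈ → ∈-star⁻ (proj₁ (∈-filter⁻ _ {xs = star S v} e∈))
              ; wrong    = λ e∈ → proj₂ (∈-filter⁻ _ {xs = star S v} e∈)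
              ; right    = λ {e} inc e∉ → decidable-stable (o e Bool.≟ o₂ e) (e∉ ∘ ∈-filter⁺ _ (∈-star inc))
              }
        ... | Xs , smalls , settledXs , bound =
          Xs , smalls , settledXs , ≤-trans bound (⊔-monoʳ-≤ k (length-filter _ (star S v)))

      repair-all : ∀ {S o} → (∀ u → deg S u < k) → Settled S o → ∀ us →
                   ∃ λ Xs → All Small Xs × Settled (us ++ S) (invertAll G o Xs) × length Xs ≤ length us
      repair-all light settled [] = [] , [] , settled , z≤n
      repair-all {S} {o} light settled (u ∷ us) with repair-all light settled us
      ... | Xs , smalls , settledXs , |Xs|≤ with u ∈? (us ++ S)
      ...   | yes u∈ = Xs , smalls , settle-member u∈ settledXs , m≤n⇒m≤1+n |Xs|≤
      ...   | no  u∉ with repair u∉ settledXs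
      ...     | Ys , smalls′ , settledYs , bound =
        Xs ++ Ys , ++⁺ smalls smalls′ ,
        subst (Settled (u ∷ us ++ S)) (sym (foldl-++ (invert G) o Xs Ys)) settledYs ,
        (begin
          length (Xs ++ Ys)       ≡⟨ length-++ Xs ⟩
          length Xs + length Ys   ≤⟨ +-mono-≤ |Xs|≤ |Ys|≤1 ⟩
          length us + 1           ≡⟨ +-comm (length us) 1 ⟩
          suc (length us)         ∎)
        where
          open ≤-Reasoning
          |Ys|≤1 : length Ys ≤ 1
          |Ys|≤1 = *-cancelˡ-≤ k (begin
            k * length Ys                   ≤⟨ bound ⟩
            k ⊔ deg (us ++ S) u             ≡⟨ m≥n⇒m⊔n≡m (<⇒≤ (≤-<-trans (deg-++ us S u) (light u))) ⟩
            k                               ≡⟨ *-identityʳ k ⟨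
            k * 1                           ∎)

      -- The schedule

      Schedule : List V → Orientation G → Set
      Schedule S o = ∃ λ Xs → All Small Xs × (∀ e → invertAll G o Xs e ≡ o₂ e) ×
                              k * length Xs ≤ size S + k * (k * suc k)

      record Advance (S : List V) (o : Orientation G) : Set where
        field
          S′      : List V
          Xs      : List (Subset (n G))
          smalls  : All Small Xs
          settled : Settled S′ (invertAll G o Xs)
          cost    : k * length Xs + size S′ ≤ size S
          shrinks : size S′ < size S

      advance-then : ∀ {S o} (adv : Advance S o) →
                     Schedule (Advance.S′ adv) (invertAll G o (Advance.Xs adv)) → Schedule S o
      advance-then {S} {o} adv (Ys , smalls′ , correct , bound) =
        Xs ++ Ys , ++⁺ smalls smalls′ ,
        (λ e → trans (cong (λ o′ → o′ e) (foldl-++ (invert G) o Xs Ys)) (correct e)) ,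
        (begin
          k * length (Xs ++ Ys)                      ≡⟨ cong (k *_) (length-++ Xs) ⟩
          k * (length Xs + length Ys)                ≡⟨ *-distribˡ-+ k (length Xs) (length Ys) ⟩
          k * length Xs + k * length Ys              ≤⟨ +-monoʳ-≤ (k * length Xs) bound ⟩
          k * length Xs + (size S′ + k * (k * suc k)) ≡⟨ +-assoc (k * length Xs) (size S′) _ ⟨
          k * length Xs + size S′ + k * (k * suc k)   ≤⟨ +-monoˡ-≤ (k * (k * suc k)) cost ⟩
          size S + k * (k * suc k)                    ∎)
        where
          open Advance adv
          open ≤-Reasoning

      advance-vertex : ∀ {S o v} → Settled S o → 0 < deg S v → k ≤ deg S v → Advance S o
      advance-vertex {S} {o} {v} settled pos k≤d with repair (0<deg⇒∉ pos) settled
      ... | Xs , smalls , settledXs , bound = record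
        { S′ = v ∷ S ; Xs = Xs ; smalls = smalls ; settled = settledXs
        ; cost    = begin
            k * length Xs + size (v ∷ S)   ≤⟨ +-monoˡ-≤ (size (v ∷ S)) (≤-trans bound (≤-reflexive (m≤n⇒m⊔n≡n k≤d))) ⟩
            deg S v + size (v ∷ S)         ≡⟨ +-comm (deg S v) (size (v ∷ S)) ⟩
            size (v ∷ S) + deg S v         ≡⟨ size-split S v ⟨
            size S                         ∎
        ; shrinks = subst (size (v ∷ S) <_) (sym (size-split S v)) (m<m+n (size (v ∷ S)) pos)
        }
        where open ≤-Reasoning

      advance-cluster : ∀ {S o Z} → Settled S o → Heavy k S Z → Advance S o
      advance-cluster {S} {o} {Z} settled heavyZ = record
        { S′ = Z ++ S ; Xs = X ∷ [] ; smalls = small ∷ []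
        ; settled = settle Z (invert-settled (cluster-∉ Z∉S W-inc scattered) settled) fixed
        ; cost    = begin
            k * 1 + size (Z ++ S)          ≡⟨ cong (_+ size (Z ++ S)) (*-identityʳ k) ⟩
            k + size (Z ++ S)              ≤⟨ +-monoˡ-≤ (size (Z ++ S)) heavy ⟩
            degSum S Z + size (Z ++ S)     ≡⟨ +-comm (degSum S Z) (size (Z ++ S)) ⟩
            size (Z ++ S) + degSum S Z     ≡⟨ size-scattered Z scattered ⟩
            size S                         ∎
        ; shrinks = subst (size (Z ++ S) <_) (size-scattered Z scattered)
                          (m<m+n (size (Z ++ S)) (≤-trans (>-nonZero⁻¹ k) heavy))
        }
        where
          open Heavy heavyZ
          open ≤-Reasoning
          W = wrongAt S o
          X = fromList (cluster Z W)
          Z∉S : All (_∉ S) Z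
          Z∉S = All.map 0<deg⇒∉ positive
          W-inc : ∀ {z e} → z ∈ Z → e ∈ W z → Incident S z e
          W-inc {z} _ e∈ = ∈-star⁻ (proj₁ (∈-filter⁻ _ {xs = star S z} e∈))
          fixed : ∀ {z e} → z ∈ Z → Incident S z e → invert G o X e ≡ o₂ e
          fixed {z} z∈ inc = corrected {o} {invert G o X}
            (λ wrong → cluster-flips Z∉S W-inc scattered {o} z∈ inc (∈-filter⁺ _ (∈-star inc) wrong))
            (λ right → cluster-keeps Z∉S W-inc scattered {o} z∈ inc
                         (λ e∈ → proj₂ (∈-filter⁻ _ {xs = star S z} e∈) right))
          small : Small X
          small = ≤-trans (∣fromList∣≤length (cluster Z W))
                 (≤-trans (length-cluster (λ z → length-filter _ (star S z)) Z) (≤-trans compact k+k≤1+c))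

      finish-cover : ∀ {S o D Z₀} → Settled S o → (∀ u → deg S u ≤ D) → D < k →
                     Covering k S Z₀ (allFin (n G)) → Schedule S o
      finish-cover {S} {o} {D} settled deg≤D D<k cov
        with Xs , smalls , settledXs , |Xs|≤
               ← repair-all (λ u → ≤-<-trans (deg≤D u) D<k) settled (cover S (Covering.Z cov))
        = Xs , smalls , correct , bound
        where
          open Covering cov
          correct : ∀ e → invertAll G o Xs e ≡ o₂ e
          correct e = settledXs e λ av → proj₁ av
            (∈-++⁺ˡ (covers (∈-allFin _) (incident⇒0<deg (avoids-++ (cover S Z) av , inj₁ refl))))
          bound : k * length Xs ≤ size S + k * (k * suc k)
          bound = ≤-trans (*-monoʳ-≤ k (≤-trans |Xs|≤ (≤-trans (length-cover deg≤D positive)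
                                                               (*-mono-≤ (<⇒≤ light) (s≤s D<k)))))
                          (m≤n+m _ (size S))

      advance-or-finish-from : ∀ {S o} v → Settled S o → (∀ u → deg S u ≤ deg S v) → 0 < deg S v →
                               Advance S o ⊎ Schedule S o
      advance-or-finish-from {S} v settled maximal pos with k ≤? deg S v
      ... | yes k≤d = inj₁ (advance-vertex settled pos k≤d)
      ... | no  k≰d with Gather.gather k maximal (allFin (n G)) (v ∷ []) initial
        where
          initial : Gather.Candidate k maximal (v ∷ [])
          initial = record
            { scattered = [] ∷ [] ; positive = pos ∷ []
            ; balanced = ≤-reflexive (cong suc (sym (+-identityʳ (deg S v))))
            ; light = ≤-trans (s≤s (≤-reflexive (+-identityʳ (deg S v)))) (≰⇒> k≰d) }
      ...   | inj₁ (Z , heavy) = inj₁ (advance-cluster settled heavy)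
      ...   | inj₂ covering    = inj₂ (finish-cover settled maximal (≰⇒> k≰d) covering)

      advance-or-finish : ∀ S {o} → Settled S o → Advance S o ⊎ Schedule S o
      advance-or-finish S settled with any? (avoids? S)
      ... | no  none       =
        inj₂ ([] , [] , (λ e → settled e (λ av → none (e , av))) , ≤-trans (≤-reflexive (*-zeroʳ k)) z≤n)
      ... | yes (e₀ , av₀) = advance-or-finish-from v settled
          (λ u → All.lookup (f[xs]≤f[argmax] {f = deg S} (end₁ e₀) (allFin (n G))) (∈-allFin u))
          (≤-trans (incident⇒0<deg (av₀ , inj₁ refl)) (f[⊥]≤f[argmax] {f = deg S} (end₁ e₀) (allFin (n G))))
        where v = argmax (deg S) (end₁ e₀) (allFin (n G))

      schedule : ∀ S {o} → Acc _<_ (size S) → Settled S o → Schedule S o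
      schedule S (acc rs) settled with advance-or-finish S settled
      ... | inj₂ done = done
      ... | inj₁ adv  = advance-then adv (schedule S′ (rs shrinks) settled′)
        where open Advance adv renaming (settled to settled′)

      reorient : ∀ o → ∃ λ Xs → All Small Xs × (∀ e → invertAll G o Xs e ≡ o₂ e) ×
                                k * length Xs ≤ m G + k * (k * suc k)
      reorient o with Xs , smalls , correct , bound ← schedule [] {o} (<-wellFounded _) nothing-settled
        = Xs , smalls , correct , ≤-trans bound (+-monoˡ-≤ (k * (k * suc k)) (size≤m []))

theorem2 : (G : Graph) (p : ℕ) → 2 ≤ p →
    (o₁ o₂ : Orientation G) →
    ∃ λ (Xs : List (Subset (n G))) →
      All (λ X → ∣ X ∣ ≤ p) Xs ×
      (∀ e → invertAll G o₁ Xs e ≡ o₂ e) ×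
      2 * length Xs ≤ 2 * ceilDiv (m G) ⌊ p /2⌋ + p * p
theorem2 G (suc zero)        (s≤s ()) o₁ o₂
theorem2 G p@(suc (suc q)) _ o₁ o₂
  with Xs , smalls , correct , bound ← Strategy.reorient G o₂ (suc q) ⌊ p /2⌋ (⌊n/2⌋+⌊n/2⌋≤n p) o₁
  = Xs , smalls , correct , length-bound q bound
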